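{- For $n\ge 0$ let $$T_n=\sum_{0\le 2k+1\le n} q^{2k^2+2k}\begin{bmatrix} n\\ 2k+1\end{bmatrix}_q,\qquad \overline{T}_n=\sum_{j\in\mathbb{Z}} q^{4j^2-3j}\begin{bmatrix} n\\ \lfloor\frac{n+2}{2}\rfloor-2j\end{bmatrix}_{q^2}.$$ Then for every integer $n\ge 0$, $$T_{n+2}-(1+q)T_{n+1}+(q-q^{2n+2})T_n=0\quad\text{and}\quad \overline{T}_{n+2}-(1+q)\overline{T}_{n+1}+(q-q^{2n+2})\overline{T}_n=0.$$
   Context: $q$ is an indeterminate. For a base $p$ (here $p=q$ or $p=q^2$) and integers $n,k$, $\begin{bmatrix} n\\ k\end{bmatrix}_p$ denotes the Gaussian binomial coefficient $\frac{(p;p)_n}{(p;p)_k(p;p)_{n-k}}$ for $0\le k\le n$ and $0$ otherwise, where $(x;p)_m=(1-x)(1-xp)\cdots(1-xp^{m-1})$. -}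

module Defs where

open import Level using (Level)
open import Algebra.Bundles using (CommutativeRing)
open import Data.Nat as ℕ using (ℕ; zero; suc; _/_)
open import Data.Integer as ℤ using (ℤ; +_; -[1+_]; ∣_∣)

module _ {c ℓ : Level} (R : CommutativeRing c ℓ) where
  open CommutativeRing R

  pow : Carrier → ℕ → Carrier
  pow x zero = 1#
  pow x (suc m) = x * pow x m

  -- Gaussian binomial [n choose k]_p, via the q-Pascal rule
  -- [n+1, k+1]_p = [n, k]_p + p^(k+1) [n, k+1]_p ; [n,0]=1 ; [0,k+1]=0
  -- (equals (p;p)_n / ((p;p)_k (p;p)_{n-k}) for 0 ≤ k ≤ n and 0 for k > n)
  gauss : Carrier → ℕ → ℕ → Carrier
  gauss p zero zero = 1#
  gauss p zero (suc k) = 0#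
  gauss p (suc n) zero = 1#
  gauss p (suc n) (suc k) = gauss p n k + pow p (suc k) * gauss p n (suc k)

  gaussℤ : Carrier → ℕ → ℤ → Carrier
  gaussℤ p n (+ k) = gauss p n k
  gaussℤ p n -[1+ k ] = 0#

  sumTo : ℕ → (ℕ → Carrier) → Carrier
  sumTo zero f = 0#
  sumTo (suc m) f = sumTo m f + f m

  sumℤ : ℕ → (ℤ → Carrier) → Carrier
  sumℤ N f = sumTo (suc N) (λ m → f (+ m)) + sumTo N (λ m → f -[1+ m ])

  -- T_n = Σ_{0 ≤ 2k+1 ≤ n} q^(2k²+2k) [n, 2k+1]_q
  -- (the range k ≤ n contains all k with 2k+1 ≤ n; the extra terms vanish
  --  since [n, 2k+1]_q = 0 when 2k+1 > n)
  T : Carrier → ℕ → Carrier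
  T q n = sumTo (suc n) (λ k → pow q (2 ℕ.* k ℕ.* k ℕ.+ 2 ℕ.* k) * gauss q n (1 ℕ.+ 2 ℕ.* k))

  -- exponent 4j² - 3j (always ≥ 0 for integer j)
  texp : ℤ → ℕ
  texp j = ∣ (+ 4) ℤ.* j ℤ.* j ℤ.- (+ 3) ℤ.* j ∣

  -- T̄_n = Σ_{j ∈ ℤ} q^(4j²-3j) [n, ⌊(n+2)/2⌋ - 2j]_{q²}
  -- (only j with |j| ≤ n+1 can give nonzero terms, as 0 ≤ ⌊(n+2)/2⌋ - 2j ≤ n forces this)
  Tbar : Carrier → ℕ → Carrier
  Tbar q n = sumℤ (suc n) (λ j → pow q (texp j) * gaussℤ (q * q) n ((+ ((n ℕ.+ 2) / 2)) ℤ.- (+ 2) ℤ.* j))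

{-# OPTIONS --safe #-}
-- Both recurrences are proved by creative telescoping, in the equivalent subtraction-free form
-- X(n+2) + q X(n) = (1 + q) X(n+1) + q^(2n+2) X(n).  For T the k-th summands of the two sides
-- differ by V(k) − V(k+1), where V(k+1) = q^(2n+2) · (k-th summand of T_n).  For T̄, with
-- N = 2m or 2m + 1, the j-th summands differ by ±(W(j) − W(j−1)) (sign + for N odd), where
-- W(j) = q^(N+1+4j²+j) [N, m − 2j]_{q²}; W vanishes at both ends of the summation range.
-- Each summand identity combines three instances of the two q-Pascal rules, weighted by powers
-- of q and used for lower indices ranging over all of ℤ.
module Submission where

open import Level using (Level)
open import Algebra.Bundles using (CommutativeRing)
open import Data.Nat using (ℕ; zero; suc; _≤_; _<_; z≤n; s≤s)
import Data.Nat as ℕ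
import Data.Nat.Properties as ℕₚ
open import Data.Nat.Divisibility using (divides)
open import Data.Nat.DivMod using (_/_; +-distrib-/-∣ʳ; m*n/n≡m; m/n<m)
open import Data.Nat.Tactic.RingSolver using () renaming (solve-∀ to ℕ-solve-∀)
open import Data.Integer as ℤ using (ℤ; +_; -[1+_]; ∣_∣; -1ℤ)
import Data.Integer.Properties as ℤₚ
open import Data.Integer.Tactic.RingSolver using () renaming (solve-∀ to ℤ-solve-∀)
open import Data.Product using (_×_; _,_; proj₁; proj₂; ∃-syntax)
open import Data.Sum using (_⊎_; inj₁; inj₂)
open import Relation.Binary.PropositionalEquality as ≡ using (_≡_; cong)

open import Defs

even-or-odd : ∀ n → (∃[ m ] n ≡ m ℕ.+ m) ⊎ (∃[ m ] n ≡ suc (m ℕ.+ m))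
even-or-odd zero = inj₁ (0 , ≡.refl)
even-or-odd (suc n) with even-or-odd n
... | inj₁ (m , ≡.refl) = inj₂ (m , ≡.refl)
... | inj₂ (m , ≡.refl) = inj₁ (suc m , cong suc (≡.sym (ℕₚ.+-suc m m)))

[d+[m+m]+2]/2≡[d+2]/2+m : ∀ d m → (d ℕ.+ (m ℕ.+ m) ℕ.+ 2) / 2 ≡ (d ℕ.+ 2) / 2 ℕ.+ m
[d+[m+m]+2]/2≡[d+2]/2+m d m = ≡.trans (cong (_/ 2) (regroup d m))
  (≡.trans (+-distrib-/-∣ʳ (d ℕ.+ 2) (divides m ≡.refl)) (cong ((d ℕ.+ 2) / 2 ℕ.+_) (m*n/n≡m m 2)))
  where
  regroup : ∀ d m → d ℕ.+ (m ℕ.+ m) ℕ.+ 2 ≡ d ℕ.+ 2 ℕ.+ m ℕ.* 2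
  regroup = ℕ-solve-∀

[n+2]/2≤1+n : ∀ n → (n ℕ.+ 2) / 2 ≤ suc n
[n+2]/2≤1+n n =
  ≡.subst (λ k → k / 2 ≤ suc n) (ℕₚ.+-comm 2 n) (ℕₚ.≤-pred (m/n<m (2 ℕ.+ n) 2 (s≤s (s≤s z≤n))))

-- The ring solver does not unfold ℤ.suc and ℤ.pred; they are written out as + 1 ℤ.+ _ and -1ℤ ℤ.+ _.
shift-index₁ : ∀ M j → (+ 1 ℤ.+ M) ℤ.- + 2 ℤ.* j ≡ + 1 ℤ.+ (M ℤ.- + 2 ℤ.* j)
shift-index₁ = ℤ-solve-∀

shift-index₂ : ∀ M j → (+ 2 ℤ.+ M) ℤ.- + 2 ℤ.* j ≡ + 1 ℤ.+ (+ 1 ℤ.+ (M ℤ.- + 2 ℤ.* j))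
shift-index₂ = ℤ-solve-∀

shift-index-pred : ∀ M j → M ℤ.- + 2 ℤ.* (-1ℤ ℤ.+ j) ≡ + 1 ℤ.+ (+ 1 ℤ.+ (M ℤ.- + 2 ℤ.* j))
shift-index-pred = ℤ-solve-∀

centred-index⁺ : ∀ {c k} w → suc c ℕ.+ w ≡ 2 ℕ.* k → + c ℤ.- + 2 ℤ.* + k ≡ -[1+ w ]
centred-index⁺ {c} {k} w eq = begin
  + c ℤ.- + 2 ℤ.* + k     ≡⟨ cong (λ i → + c ℤ.- i) (≡.trans (≡.sym (ℤₚ.pos-* 2 k)) (cong +_ (≡.sym eq))) ⟩
  + c ℤ.- + (suc c ℕ.+ w) ≡⟨ cancel (+ c) (+ w) ⟩
  -[1+ w ]                ∎
  where
  open ≡.≡-Reasoning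
  cancel : ∀ C W → C ℤ.- (+ 1 ℤ.+ C ℤ.+ W) ≡ ℤ.- (+ 1 ℤ.+ W)
  cancel = ℤ-solve-∀

centred-index⁻ : ∀ c k → + c ℤ.- + 2 ℤ.* -[1+ k ] ≡ + (c ℕ.+ suc k ℕ.+ suc k)
centred-index⁻ c k = expand (+ c) (+ k)
  where
  expand : ∀ C K → C ℤ.- + 2 ℤ.* ℤ.- (+ 1 ℤ.+ K) ≡ C ℤ.+ (+ 1 ℤ.+ K) ℤ.+ (+ 1 ℤ.+ K)
  expand = ℤ-solve-∀

subst-+≡+ : ∀ P {E e T t Q} → E ≡ e → T ≡ t → P ℤ.+ e ≡ t ℤ.+ Q → P ℤ.+ E ≡ T ℤ.+ Q
subst-+≡+ P ≡.refl ≡.refl eq = eq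

+∣∣-of-product : ∀ {i} a b → i ≡ + a ℤ.* + b → + ∣ i ∣ ≡ i
+∣∣-of-product a b eq with ≡.refl ← ≡.trans eq (≡.sym (ℤₚ.pos-* a b)) = ≡.refl

certificate-exp : ℤ → ℕ
certificate-exp j = ∣ + 4 ℤ.* j ℤ.* j ℤ.+ j ∣

+certificate-exp : ∀ j → + certificate-exp j ≡ + 4 ℤ.* j ℤ.* j ℤ.+ j
+certificate-exp (+ k)    = +∣∣-of-product k (k ℕ.+ k ℕ.+ k ℕ.+ k ℕ.+ 1) (factor (+ k))
  where
  factor : ∀ K → + 4 ℤ.* K ℤ.* K ℤ.+ K ≡ K ℤ.* (K ℤ.+ K ℤ.+ K ℤ.+ K ℤ.+ + 1)
  factor = ℤ-solve-∀
+certificate-exp -[1+ k ] = +∣∣-of-product (suc k) (k ℕ.+ k ℕ.+ k ℕ.+ k ℕ.+ 3) (factor (+ k))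
  where
  factor : ∀ K → + 4 ℤ.* ℤ.- (+ 1 ℤ.+ K) ℤ.* ℤ.- (+ 1 ℤ.+ K) ℤ.+ ℤ.- (+ 1 ℤ.+ K)
                 ≡ (+ 1 ℤ.+ K) ℤ.* (K ℤ.+ K ℤ.+ K ℤ.+ K ℤ.+ + 3)
  factor = ℤ-solve-∀

module _ {c ℓ : Level} (R : CommutativeRing c ℓ) where

  open CommutativeRing R hiding (zero)
  open import Relation.Binary.Reasoning.Setoid setoid
  open import Algebra.Properties.Semiring.Exp semiring using (_^_; ^-congˡ; ^-homo-*; ^-assocʳ)
  open import Algebra.Properties.CommutativeSemigroup +-commutativeSemigroup
    using () renaming (interchange to +-interchange)
  open import Algebra.Properties.AbelianGroup +-abelianGroup using (∙-cancelʳ; ⁻¹-∙-comm)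
  open import Algebra.Properties.Ring ring using (-‿distribˡ-*)
  open import Algebra.Solver.Ring.NaturalCoefficients.Default commutativeSemiring

  +texp : ∀ j → + texp R j ≡ + 4 ℤ.* j ℤ.* j ℤ.- + 3 ℤ.* j
  +texp (+ zero)    = ≡.refl
  +texp (+ suc k)   = +∣∣-of-product (suc k) (k ℕ.+ k ℕ.+ k ℕ.+ k ℕ.+ 1) (factor (+ k))
    where
    factor : ∀ K → + 4 ℤ.* (+ 1 ℤ.+ K) ℤ.* (+ 1 ℤ.+ K) ℤ.- + 3 ℤ.* (+ 1 ℤ.+ K)
                   ≡ (+ 1 ℤ.+ K) ℤ.* (K ℤ.+ K ℤ.+ K ℤ.+ K ℤ.+ + 1)
    factor = ℤ-solve-∀
  +texp -[1+ k ]    = +∣∣-of-product (suc k) (k ℕ.+ k ℕ.+ k ℕ.+ k ℕ.+ 7) (factor (+ k))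
    where
    factor : ∀ K → + 4 ℤ.* ℤ.- (+ 1 ℤ.+ K) ℤ.* ℤ.- (+ 1 ℤ.+ K) ℤ.- + 3 ℤ.* ℤ.- (+ 1 ℤ.+ K)
                   ≡ (+ 1 ℤ.+ K) ℤ.* (K ℤ.+ K ℤ.+ K ℤ.+ K ℤ.+ + 7)
    factor = ℤ-solve-∀

  absorbʳ : ∀ {u} v → u ≈ u + v * 0#
  absorbʳ {u} v = sym (trans (+-congˡ (zeroʳ v)) (+-identityʳ u))

  cancel-zeros : ∀ {x y u v} → x + u ≈ y + v → u ≈ 0# → v ≈ 0# → x ≈ y
  cancel-zeros {x} {y} {u} {v} eq u≈0 v≈0 = begin
    x      ≈⟨ sym (+-identityʳ x) ⟩
    x + 0# ≈⟨ +-congˡ (sym u≈0) ⟩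
    x + u  ≈⟨ eq ⟩
    y + v  ≈⟨ +-congˡ v≈0 ⟩
    y + 0# ≈⟨ +-identityʳ y ⟩
    y      ∎

  pascal-combination : ∀ {q A B C U V P} → A ≈ B + (U + P) → q * B ≈ q * C + V →
                       (A + q * C) + V ≈ ((1# + q) * B + P) + U
  pascal-combination {q} {A} {B} {C} {U} {V} {P} outer inner = begin
    (A + q * C) + V             ≈⟨ +-congʳ (+-congʳ outer) ⟩
    ((B + (U + P)) + q * C) + V ≈⟨ solve 5 (λ B U P qC V → ((B :+ (U :+ P)) :+ qC) :+ V
                                                        := ((B :+ (qC :+ V)) :+ P) :+ U) refl B U P (q * C) V ⟩
    ((B + (q * C + V)) + P) + U ≈⟨ +-congʳ (+-congʳ (+-congˡ (sym inner))) ⟩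
    ((B + q * B) + P) + U       ≈⟨ +-congʳ (+-congʳ (sym (trans (distribʳ B 1# q) (+-congʳ (*-identityˡ B))))) ⟩
    ((1# + q) * B + P) + U      ∎

  recurrence-of-balance : ∀ {X Y Z a q Q} → X + q * Y ≈ a * Z + Q * Y → (X - a * Z) + (q - Q) * Y ≈ 0#
  recurrence-of-balance {X} {Y} {Z} {a} {q} {Q} balance = begin
    (X - a * Z) + (q - Q) * Y
      ≈⟨ +-congˡ (trans (distribʳ Y q (- Q)) (+-congˡ (sym (-‿distribˡ-* Q Y)))) ⟩
    (X - a * Z) + (q * Y - Q * Y)
      ≈⟨ +-interchange X (- (a * Z)) (q * Y) (- (Q * Y)) ⟩
    (X + q * Y) + (- (a * Z) + - (Q * Y))
      ≈⟨ +-cong balance (⁻¹-∙-comm (a * Z) (Q * Y)) ⟩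
    (a * Z + Q * Y) - (a * Z + Q * Y)
      ≈⟨ -‿inverseʳ _ ⟩
    0# ∎

  pow≡^ : ∀ x n → pow R x n ≡ x ^ n
  pow≡^ x zero    = ≡.refl
  pow≡^ x (suc n) = cong (x *_) (pow≡^ x n)

  pow-homo-* : ∀ x m n → pow R x (m ℕ.+ n) ≈ pow R x m * pow R x n
  pow-homo-* x m n rewrite pow≡^ x (m ℕ.+ n) | pow≡^ x m | pow≡^ x n = ^-homo-* x m n

  pow-of-pow : ∀ {p x e} → p ≈ pow R x e → ∀ n → pow R p n ≈ pow R x (e ℕ.* n)
  pow-of-pow {p} {x} {e} p≈xᵉ n rewrite pow≡^ p n | pow≡^ x (e ℕ.* n) =
    trans (^-congˡ n (trans p≈xᵉ (reflexive (pow≡^ x e)))) (^-assocʳ x e n)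

  -- Gaussian binomial coefficients

  gauss-0 : ∀ p n → gauss R p n 0 ≡ 1#
  gauss-0 p zero    = ≡.refl
  gauss-0 p (suc n) = ≡.refl

  gauss-vanish : ∀ p {n k} → n < k → gauss R p n k ≈ 0#
  gauss-vanish p {zero}  {suc k} _         = refl
  gauss-vanish p {suc n} {suc k} (s≤s n<k) = begin
    gauss R p n k + pow R p (suc k) * gauss R p n (suc k)
      ≈⟨ +-cong (gauss-vanish p n<k) (*-congˡ (gauss-vanish p (ℕₚ.m<n⇒m<1+n n<k))) ⟩
    0# + pow R p (suc k) * 0#
      ≈⟨ trans (+-identityˡ _) (zeroʳ _) ⟩
    0# ∎

  gauss-diag : ∀ p n → gauss R p n n ≈ 1#
  gauss-diag p zero    = refl
  gauss-diag p (suc n) = begin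
    gauss R p n n + pow R p (suc n) * gauss R p n (suc n)
      ≈⟨ +-cong (gauss-diag p n) (*-congˡ (gauss-vanish p (ℕₚ.n<1+n n))) ⟩
    1# + pow R p (suc n) * 0#
      ≈⟨ sym (absorbʳ _) ⟩
    1# ∎

  gauss-pascal₂ : ∀ p k d →
    gauss R p (suc (k ℕ.+ d)) (suc k) ≈ gauss R p (k ℕ.+ d) (suc k) + pow R p d * gauss R p (k ℕ.+ d) k
  gauss-pascal₂ p zero zero =
    solve 1 (λ p → con 1 :+ (p :* con 1) :* con 0 := con 0 :+ con 1 :* con 1) refl p
  gauss-pascal₂ p zero (suc d) = begin
    1# + (p * 1#) * gauss R p (suc d) 1
      ≈⟨ +-congˡ (*-congˡ (gauss-pascal₂ p zero d)) ⟩
    1# + (p * 1#) * (gauss R p d 1 + pow R p d * gauss R p d 0)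
      ≡⟨ cong (λ g → 1# + (p * 1#) * (gauss R p d 1 + pow R p d * g)) (gauss-0 p d) ⟩
    1# + (p * 1#) * (gauss R p d 1 + pow R p d * 1#)
      ≈⟨ solve 3 (λ p g pᵈ → con 1 :+ (p :* con 1) :* (g :+ pᵈ :* con 1)
                             := (con 1 :+ (p :* con 1) :* g) :+ (p :* pᵈ) :* con 1)
               refl p (gauss R p d 1) (pow R p d) ⟩
    (1# + (p * 1#) * gauss R p d 1) + (p * pow R p d) * 1#
      ≡⟨ cong (λ g → (g + (p * 1#) * gauss R p d 1) + (p * pow R p d) * 1#) (≡.sym (gauss-0 p d)) ⟩
    gauss R p (suc d) 1 + pow R p (suc d) * gauss R p (suc d) 0 ∎
  gauss-pascal₂ p (suc k) zero rewrite ℕₚ.+-identityʳ k = begin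
    gauss R p (suc (suc k)) (suc (suc k))
      ≈⟨ gauss-diag p (suc (suc k)) ⟩
    1#
      ≈⟨ sym (trans (+-identityˡ _) (*-identityˡ _)) ⟩
    0# + 1# * 1#
      ≈⟨ sym (+-cong (gauss-vanish p (ℕₚ.n<1+n (suc k))) (*-congˡ (gauss-diag p (suc k)))) ⟩
    gauss R p (suc k) (suc (suc k)) + 1# * gauss R p (suc k) (suc k) ∎
  gauss-pascal₂ p (suc k) (suc d) = begin
    gauss R p (suc n) (suc k) + pow R p (suc (suc k)) * gauss R p (suc n) (suc (suc k))
      ≈⟨ +-cong (gauss-pascal₂ p k (suc d)) (*-congˡ pascal-above) ⟩
    (gauss R p n (suc k) + pow R p (suc d) * gauss R p n k)
      + pow R p (suc (suc k)) * (gauss R p n (suc (suc k)) + pow R p d * gauss R p n (suc k))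
      ≈⟨ solve 6 (λ p pᵏ pᵈ a b c →
              (a :+ (p :* pᵈ) :* b) :+ (p :* (p :* pᵏ)) :* (c :+ pᵈ :* a)
           := (a :+ (p :* (p :* pᵏ)) :* c) :+ (p :* pᵈ) :* (b :+ (p :* pᵏ) :* a))
           refl p (pow R p k) (pow R p d) (gauss R p n (suc k)) (gauss R p n k) (gauss R p n (suc (suc k))) ⟩
    gauss R p (suc n) (suc (suc k)) + pow R p (suc d) * gauss R p (suc n) (suc k) ∎
    where
    n : ℕ
    n = k ℕ.+ suc d
    pascal-above : gauss R p (suc n) (suc (suc k)) ≈ gauss R p n (suc (suc k)) + pow R p d * gauss R p n (suc k)
    pascal-above rewrite ℕₚ.+-suc k d = gauss-pascal₂ p (suc k) d

  -- The coefficients p^(k+1) and p^(n−k) of the two Pascal rules appear as ratios x^b / x^a.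
  -- Prescribing b by a linear equation instead of a formula keeps the rules meaningful for lower
  -- indices outside [0, n], where both sides vanish but n − k may be negative.
  module WeightedPascal {p x : Carrier} {e : ℕ} (p≈xᵉ : p ≈ pow R x e) where

    weight-shift : ∀ {a b} m → b ≡ a ℕ.+ e ℕ.* m → pow R x a * pow R p m ≈ pow R x b
    weight-shift {a} m ≡.refl = trans (*-congˡ (pow-of-pow {x = x} {e = e} p≈xᵉ m)) (sym (pow-homo-* x a (e ℕ.* m)))

    weighted-pascal₂ : ∀ n k a b → b ℕ.+ e ℕ.* suc k ≡ a ℕ.+ e ℕ.* suc n →
      pow R x a * gauss R p (suc n) (suc k) ≈ pow R x a * gauss R p n (suc k) + pow R x b * gauss R p n k
    weighted-pascal₂ n k a b rel with ℕₚ.≤-<-connex k n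
    ... | inj₁ k≤n with d , ≡.refl ← ℕₚ.m≤n⇒∃[o]m+o≡n k≤n = begin
      pow R x a * gauss R p (suc n) (suc k)
        ≈⟨ *-congˡ (gauss-pascal₂ p k d) ⟩
      pow R x a * (gauss R p n (suc k) + pow R p d * gauss R p n k)
        ≈⟨ trans (distribˡ _ _ _) (+-congˡ (sym (*-assoc _ _ _))) ⟩
      pow R x a * gauss R p n (suc k) + (pow R x a * pow R p d) * gauss R p n k
        ≈⟨ +-congˡ (*-congʳ (weight-shift d b≡a+ed)) ⟩
      pow R x a * gauss R p n (suc k) + pow R x b * gauss R p n k ∎
      where
      expand : ∀ a e k d → a ℕ.+ e ℕ.* suc (k ℕ.+ d) ≡ (a ℕ.+ e ℕ.* d) ℕ.+ e ℕ.* suc k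
      expand = ℕ-solve-∀
      b≡a+ed : b ≡ a ℕ.+ e ℕ.* d
      b≡a+ed = ℕₚ.+-cancelʳ-≡ _ b _ (≡.trans rel (expand a e k d))
    ... | inj₂ n<k = begin
      pow R x a * gauss R p (suc n) (suc k)  ≈⟨ *-congˡ (gauss-vanish p (s≤s n<k)) ⟩
      pow R x a * 0#                         ≈⟨ absorbʳ _ ⟩
      pow R x a * 0# + pow R x b * 0#        ≈⟨ sym (+-cong (*-congˡ (gauss-vanish p (ℕₚ.m<n⇒m<1+n n<k)))
                                                            (*-congˡ (gauss-vanish p n<k))) ⟩
      pow R x a * gauss R p n (suc k) + pow R x b * gauss R p n k ∎

    private
      +-linear : ∀ a m → + a ℤ.+ + e ℤ.* + m ≡ + (a ℕ.+ e ℕ.* m)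
      +-linear a m = cong (λ i → + a ℤ.+ i) (≡.sym (ℤₚ.pos-* e m))

    weighted-pascal₁ℤ : ∀ n r a b → + b ≡ + a ℤ.+ + e ℤ.* ℤ.suc r →
      pow R x a * gaussℤ R p (suc n) (ℤ.suc r)
        ≈ pow R x a * gaussℤ R p n r + pow R x b * gaussℤ R p n (ℤ.suc r)
    weighted-pascal₁ℤ n (+ k) a b rel = begin
      pow R x a * (gauss R p n k + pow R p (suc k) * gauss R p n (suc k))
        ≈⟨ trans (distribˡ _ _ _) (+-congˡ (sym (*-assoc _ _ _))) ⟩
      pow R x a * gauss R p n k + (pow R x a * pow R p (suc k)) * gauss R p n (suc k)
        ≈⟨ +-congˡ (*-congʳ (weight-shift (suc k) (ℤₚ.+-injective (≡.trans rel (+-linear a (suc k)))))) ⟩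
      pow R x a * gauss R p n k + pow R x b * gauss R p n (suc k) ∎
    weighted-pascal₁ℤ n -[1+ zero ] a b rel = begin
      pow R x a * 1#                  ≈⟨ weight-shift 0 (ℤₚ.+-injective (≡.trans rel (+-linear a 0))) ⟩
      pow R x b                       ≈⟨ sym (trans (+-cong (zeroʳ _) (*-identityʳ _)) (+-identityˡ _)) ⟩
      pow R x a * 0# + pow R x b * 1# ≡⟨ cong (λ g → pow R x a * 0# + pow R x b * g) (≡.sym (gauss-0 p n)) ⟩
      pow R x a * 0# + pow R x b * gauss R p n 0 ∎
    weighted-pascal₁ℤ n -[1+ suc k ] a b rel = absorbʳ _

    weighted-pascal₂ℤ : ∀ n r a b → + b ℤ.+ + e ℤ.* ℤ.suc r ≡ + a ℤ.+ + e ℤ.* + suc n →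
      pow R x a * gaussℤ R p (suc n) (ℤ.suc r)
        ≈ pow R x a * gaussℤ R p n (ℤ.suc r) + pow R x b * gaussℤ R p n r
    weighted-pascal₂ℤ n (+ k) a b rel = weighted-pascal₂ n k a b
      (ℤₚ.+-injective (≡.trans (≡.sym (+-linear b (suc k))) (≡.trans rel (+-linear a (suc n)))))
    weighted-pascal₂ℤ n -[1+ zero ] a b rel rewrite gauss-0 p n = absorbʳ _
    weighted-pascal₂ℤ n -[1+ suc k ] a b rel = absorbʳ _

  -- Finite sums

  sumTo-cong : ∀ m {f g : ℕ → Carrier} → (∀ k → f k ≈ g k) → sumTo R m f ≈ sumTo R m g
  sumTo-cong zero    f≈g = refl
  sumTo-cong (suc m) f≈g = +-cong (sumTo-cong m f≈g) (f≈g m)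

  sumTo-+ : ∀ m f g → sumTo R m (λ k → f k + g k) ≈ sumTo R m f + sumTo R m g
  sumTo-+ zero    f g = sym (+-identityˡ 0#)
  sumTo-+ (suc m) f g = trans (+-congʳ (sumTo-+ m f g)) (+-interchange _ _ _ _)

  sumTo-*ˡ : ∀ m a f → sumTo R m (λ k → a * f k) ≈ a * sumTo R m f
  sumTo-*ˡ zero    a f = sym (zeroʳ a)
  sumTo-*ˡ (suc m) a f = trans (+-congʳ (sumTo-*ˡ m a f)) (sym (distribˡ a _ _))

  sumTo-shift : ∀ m f → sumTo R (suc m) f ≈ f 0 + sumTo R m (λ k → f (suc k))
  sumTo-shift zero    f = trans (+-identityˡ _) (sym (+-identityʳ _))
  sumTo-shift (suc m) f = trans (+-congʳ (sumTo-shift m f)) (+-assoc _ _ _)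

  sumTo-extend : ∀ {m M} f → m ≤ M → (∀ k → m ≤ k → f k ≈ 0#) → sumTo R M f ≈ sumTo R m f
  sumTo-extend {M = zero}  f z≤n _ = refl
  sumTo-extend {M = suc M} f m≤M+1 tail with ℕₚ.m≤n⇒m<n∨m≡n m≤M+1
  ... | inj₁ (s≤s m≤M) = trans (+-cong (sumTo-extend f m≤M tail) (tail M m≤M)) (+-identityʳ _)
  ... | inj₂ ≡.refl    = refl

  sumTo-telescope : ∀ m {f g V : ℕ → Carrier} → (∀ k → f k + V (suc k) ≈ g k + V k) →
                    sumTo R m f + V m ≈ sumTo R m g + V 0
  sumTo-telescope zero    step = refl
  sumTo-telescope (suc m) {f} {g} {V} step = begin
    (sumTo R m f + f m) + V (suc m) ≈⟨ +-assoc _ _ _ ⟩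
    sumTo R m f + (f m + V (suc m)) ≈⟨ +-congˡ (step m) ⟩
    sumTo R m f + (g m + V m)       ≈⟨ solve 3 (λ F g V → F :+ (g :+ V) := (F :+ V) :+ g)
                                               refl (sumTo R m f) (g m) (V m) ⟩
    (sumTo R m f + V m) + g m       ≈⟨ +-congʳ (sumTo-telescope m step) ⟩
    (sumTo R m g + V 0) + g m       ≈⟨ solve 3 (λ G V g → (G :+ V) :+ g := (G :+ g) :+ V)
                                               refl (sumTo R m g) (V 0) (g m) ⟩
    (sumTo R m g + g m) + V 0       ∎

  sumℤ-+ : ∀ K f g → sumℤ R K (λ j → f j + g j) ≈ sumℤ R K f + sumℤ R K g
  sumℤ-+ K f g = trans
    (+-cong (sumTo-+ (suc K) (λ k → f (+ k)) (λ k → g (+ k))) (sumTo-+ K (λ k → f -[1+ k ]) (λ k → g -[1+ k ])))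
    (+-interchange _ _ _ _)

  sumℤ-*ˡ : ∀ K a f → sumℤ R K (λ j → a * f j) ≈ a * sumℤ R K f
  sumℤ-*ˡ K a f = trans
    (+-cong (sumTo-*ˡ (suc K) a (λ k → f (+ k))) (sumTo-*ˡ K a (λ k → f -[1+ k ])))
    (sym (distribˡ a _ _))

  sumℤ-extend : ∀ {M K} f → M ≤ K →
                (∀ k → M < k → f (+ k) ≈ 0#) → (∀ k → M ≤ k → f -[1+ k ] ≈ 0#) →
                sumℤ R K f ≈ sumℤ R M f
  sumℤ-extend f M≤K tail⁺ tail⁻ =
    +-cong (sumTo-extend (λ k → f (+ k)) (s≤s M≤K) tail⁺) (sumTo-extend (λ k → f -[1+ k ]) M≤K tail⁻)

  sumℤ-balance : ∀ K {A B C} a b c →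
                 sumℤ R K (λ j → A j + a * C j) ≈ sumℤ R K (λ j → b * B j + c * C j) →
                 sumℤ R K A + a * sumℤ R K C ≈ b * sumℤ R K B + c * sumℤ R K C
  sumℤ-balance K {A} {B} {C} a b c termwise = begin
    sumℤ R K A + a * sumℤ R K C        ≈⟨ sym (trans (sumℤ-+ K A (λ j → a * C j)) (+-congˡ (sumℤ-*ˡ K a C))) ⟩
    sumℤ R K (λ j → A j + a * C j)     ≈⟨ termwise ⟩
    sumℤ R K (λ j → b * B j + c * C j) ≈⟨ trans (sumℤ-+ K (λ j → b * B j) (λ j → c * C j))
                                                  (+-cong (sumℤ-*ˡ K b B) (sumℤ-*ˡ K c C)) ⟩
    b * sumℤ R K B + c * sumℤ R K C    ∎

  -- The nonnegative and the negative half telescope separately and meet at W (-1).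
  sumℤ-telescope : ∀ K {f g W : ℤ → Carrier} → (∀ j → f j + W (ℤ.pred j) ≈ g j + W j) →
                   sumℤ R K f + W -[1+ K ] ≈ sumℤ R K g + W (+ K)
  sumℤ-telescope K {f} {g} {W} step = begin
    (F⁺ + F⁻) + W -[1+ K ] ≈⟨ +-assoc _ _ _ ⟩
    F⁺ + (F⁻ + W -[1+ K ]) ≈⟨ +-congˡ negative ⟩
    F⁺ + (G⁻ + W -[1+ 0 ]) ≈⟨ solve 3 (λ F G W → F :+ (G :+ W) := (F :+ W) :+ G) refl F⁺ G⁻ (W -[1+ 0 ]) ⟩
    (F⁺ + W -[1+ 0 ]) + G⁻ ≈⟨ +-congʳ (sym nonnegative) ⟩
    (G⁺ + W (+ K)) + G⁻    ≈⟨ solve 3 (λ G W H → (G :+ W) :+ H := (G :+ H) :+ W) refl G⁺ (W (+ K)) G⁻ ⟩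
    (G⁺ + G⁻) + W (+ K)    ∎
    where
    F⁺ G⁺ F⁻ G⁻ : Carrier
    F⁺ = sumTo R (suc K) (λ k → f (+ k))
    G⁺ = sumTo R (suc K) (λ k → g (+ k))
    F⁻ = sumTo R K (λ k → f -[1+ k ])
    G⁻ = sumTo R K (λ k → g -[1+ k ])
    nonnegative : G⁺ + W (+ K) ≈ F⁺ + W -[1+ 0 ]
    nonnegative = sumTo-telescope (suc K) {λ k → g (+ k)} {λ k → f (+ k)} {λ k → W (ℤ.pred (+ k))}
                                  (λ k → sym (step (+ k)))
    negative : F⁻ + W -[1+ K ] ≈ G⁻ + W -[1+ 0 ]
    negative = sumTo-telescope K {λ k → f -[1+ k ]} {λ k → g -[1+ k ]} {λ k → W -[1+ k ]} (λ k → step -[1+ k ])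

  module _ (q : Carrier) where

    Q : ℕ → Carrier
    Q n = pow R q (2 ℕ.* n ℕ.+ 2)

    -- The recurrence for T

    T-summand : ℕ → ℕ → Carrier
    T-summand n k = pow R q (2 ℕ.* k ℕ.* k ℕ.+ 2 ℕ.* k) * gauss R q n (1 ℕ.+ 2 ℕ.* k)

    T-certificate : ℕ → ℕ → Carrier
    T-certificate n zero    = 0#
    T-certificate n (suc k) = Q n * T-summand n k

    open WeightedPascal {x = q} {e = 1} (sym (*-identityʳ q)) using (weighted-pascal₂)

    T-certificate-step : ∀ n k → pow R q (2 ℕ.* k ℕ.* k ℕ.+ suc n) * gauss R q (suc n) (2 ℕ.* k)
                                 ≈ pow R q (2 ℕ.* k ℕ.* k ℕ.+ suc n) * gauss R q n (2 ℕ.* k) + T-certificate n k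
    T-certificate-step n zero rewrite gauss-0 q n = sym (+-identityʳ _)
    T-certificate-step n (suc i) = begin
      u * gauss R q (suc n) (2 ℕ.* suc i)
        ≡⟨ cong (λ k → u * gauss R q (suc n) k) (double-suc i) ⟩
      u * gauss R q (suc n) (suc (1 ℕ.+ 2 ℕ.* i))
        ≈⟨ weighted-pascal₂ n (1 ℕ.+ 2 ℕ.* i) (2 ℕ.* suc i ℕ.* suc i ℕ.+ suc n) (2 ℕ.* n ℕ.+ 2 ℕ.+ a)
                            (weights i n) ⟩
      u * gauss R q n (suc (1 ℕ.+ 2 ℕ.* i)) + pow R q (2 ℕ.* n ℕ.+ 2 ℕ.+ a) * gauss R q n (1 ℕ.+ 2 ℕ.* i)
        ≈⟨ +-congˡ (trans (*-congʳ (pow-homo-* q (2 ℕ.* n ℕ.+ 2) a)) (*-assoc _ _ _)) ⟩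
      u * gauss R q n (suc (1 ℕ.+ 2 ℕ.* i)) + T-certificate n (suc i)
        ≡⟨ cong (λ k → u * gauss R q n k + T-certificate n (suc i)) (≡.sym (double-suc i)) ⟩
      u * gauss R q n (2 ℕ.* suc i) + T-certificate n (suc i) ∎
      where
      a : ℕ
      a = 2 ℕ.* i ℕ.* i ℕ.+ 2 ℕ.* i
      u : Carrier
      u = pow R q (2 ℕ.* suc i ℕ.* suc i ℕ.+ suc n)
      double-suc : ∀ i → 2 ℕ.* suc i ≡ suc (1 ℕ.+ 2 ℕ.* i)
      double-suc = ℕ-solve-∀
      weights : ∀ i n → (2 ℕ.* n ℕ.+ 2 ℕ.+ (2 ℕ.* i ℕ.* i ℕ.+ 2 ℕ.* i)) ℕ.+ 1 ℕ.* suc (1 ℕ.+ 2 ℕ.* i)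
                        ≡ (2 ℕ.* suc i ℕ.* suc i ℕ.+ suc n) ℕ.+ 1 ℕ.* suc n
      weights = ℕ-solve-∀

    -- Both Pascal expansions leave the same remainder u [n, 2k]_q, which cancels.
    T-step : ∀ n k → T-summand (2 ℕ.+ n) k + q * T-summand n k
                     ≈ (1# + q) * T-summand (1 ℕ.+ n) k + T-certificate n k
    T-step n k = ∙-cancelʳ (u * gauss R q n (2 ℕ.* k)) _ _ (pascal-combination outer inner)
      where
      a b : ℕ
      a = 2 ℕ.* k ℕ.* k ℕ.+ 2 ℕ.* k
      b = 2 ℕ.* k ℕ.* k ℕ.+ suc n
      u : Carrier
      u = pow R q b
      outer-weights : ∀ k n → (2 ℕ.* k ℕ.* k ℕ.+ suc n) ℕ.+ 1 ℕ.* suc (2 ℕ.* k)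
                              ≡ (2 ℕ.* k ℕ.* k ℕ.+ 2 ℕ.* k) ℕ.+ 1 ℕ.* suc (suc n)
      outer-weights = ℕ-solve-∀
      inner-weights : ∀ k n → (2 ℕ.* k ℕ.* k ℕ.+ suc n) ℕ.+ 1 ℕ.* suc (2 ℕ.* k)
                              ≡ suc (2 ℕ.* k ℕ.* k ℕ.+ 2 ℕ.* k) ℕ.+ 1 ℕ.* suc n
      inner-weights = ℕ-solve-∀
      outer : T-summand (2 ℕ.+ n) k ≈ T-summand (1 ℕ.+ n) k + (u * gauss R q n (2 ℕ.* k) + T-certificate n k)
      outer = trans (weighted-pascal₂ (suc n) (2 ℕ.* k) a b (outer-weights k n)) (+-congˡ (T-certificate-step n k))
      inner : q * T-summand (1 ℕ.+ n) k ≈ q * T-summand n k + u * gauss R q n (2 ℕ.* k)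
      inner = begin
        q * (pow R q a * gauss R q (suc n) (suc (2 ℕ.* k)))
          ≈⟨ sym (*-assoc _ _ _) ⟩
        pow R q (suc a) * gauss R q (suc n) (suc (2 ℕ.* k))
          ≈⟨ weighted-pascal₂ n (2 ℕ.* k) (suc a) b (inner-weights k n) ⟩
        pow R q (suc a) * gauss R q n (suc (2 ℕ.* k)) + u * gauss R q n (2 ℕ.* k)
          ≈⟨ +-congʳ (*-assoc _ _ _) ⟩
        q * T-summand n k + u * gauss R q n (2 ℕ.* k) ∎

    T-extend : ∀ n {M} → n ≤ M → sumTo R (suc M) (T-summand n) ≈ T R q n
    T-extend n n≤M = sumTo-extend (T-summand n) (s≤s n≤M) vanish
      where
      vanish : ∀ k → suc n ≤ k → T-summand n k ≈ 0#
      vanish k n<k =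
        trans (*-congˡ (gauss-vanish q (ℕₚ.m<n⇒m<1+n (ℕₚ.<-≤-trans n<k (ℕₚ.m≤m+n k (k ℕ.+ 0)))))) (zeroʳ _)

    T-certificate-sum : ∀ n m → sumTo R (suc m) (T-certificate n) ≈ Q n * sumTo R m (T-summand n)
    T-certificate-sum n m = trans (sumTo-shift m _) (trans (+-identityˡ _) (sumTo-*ˡ m (Q n) (T-summand n)))

    T-balanced : ∀ n → T R q (2 ℕ.+ n) + q * T R q n ≈ (1# + q) * T R q (1 ℕ.+ n) + Q n * T R q n
    T-balanced n = begin
      T R q (2 ℕ.+ n) + q * T R q n
        ≈⟨ +-congˡ (*-congˡ (sym (T-extend n (ℕₚ.m≤n+m n 2)))) ⟩
      sumTo R (3 ℕ.+ n) (T-summand (2 ℕ.+ n)) + q * sumTo R (3 ℕ.+ n) (T-summand n)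
        ≈⟨ sym (trans (sumTo-+ (3 ℕ.+ n) _ _) (+-congˡ (sumTo-*ˡ (3 ℕ.+ n) q _))) ⟩
      sumTo R (3 ℕ.+ n) (λ k → T-summand (2 ℕ.+ n) k + q * T-summand n k)
        ≈⟨ sumTo-cong (3 ℕ.+ n) (T-step n) ⟩
      sumTo R (3 ℕ.+ n) (λ k → (1# + q) * T-summand (1 ℕ.+ n) k + T-certificate n k)
        ≈⟨ trans (sumTo-+ (3 ℕ.+ n) _ _) (+-congʳ (sumTo-*ˡ (3 ℕ.+ n) (1# + q) _)) ⟩
      (1# + q) * sumTo R (3 ℕ.+ n) (T-summand (1 ℕ.+ n)) + sumTo R (3 ℕ.+ n) (T-certificate n)
        ≈⟨ +-cong (*-congˡ (T-extend (1 ℕ.+ n) (ℕₚ.n≤1+n _)))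
                  (trans (T-certificate-sum n (2 ℕ.+ n)) (*-congˡ (T-extend n (ℕₚ.n≤1+n n)))) ⟩
      (1# + q) * T R q (1 ℕ.+ n) + Q n * T R q n ∎

    -- The recurrence for T̄

    open WeightedPascal {x = q} {e = 2} (*-congˡ (sym (*-identityʳ q))) using (weighted-pascal₁ℤ; weighted-pascal₂ℤ)

    weighted : ℕ → ℕ → ℤ → Carrier
    weighted t n i = pow R q t * gaussℤ R (q * q) n i

    weighted-index : ∀ t n {i i′} → i ≡ i′ → weighted t n i ≈ weighted t n i′
    weighted-index t n eq = reflexive (cong (weighted t n) eq)

    weighted-suc : ∀ t n i → q * weighted t n i ≈ weighted (suc t) n i
    weighted-suc t n i = sym (*-assoc q _ _)

    weighted-Q : ∀ N t n i → weighted (suc N ℕ.+ suc N ℕ.+ t) n i ≈ Q N * weighted t n i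
    weighted-Q N t n i =
      trans (*-congʳ (trans (reflexive (cong (pow R q) (double N t))) (pow-homo-* q (2 ℕ.* N ℕ.+ 2) t)))
            (*-assoc _ _ _)
      where
      double : ∀ N t → suc N ℕ.+ suc N ℕ.+ t ≡ 2 ℕ.* N ℕ.+ 2 ℕ.+ t
      double = ℕ-solve-∀

    weighted-vanish⁺ : ∀ t n {c k} → c < 2 ℕ.* k → weighted t n (+ c ℤ.- + 2 ℤ.* + k) ≈ 0#
    weighted-vanish⁺ t n {c} {k} c<2k with w , eq ← ℕₚ.m≤n⇒∃[o]m+o≡n c<2k =
      trans (weighted-index t n (centred-index⁺ {c} {k} w eq)) (zeroʳ _)

    weighted-vanish⁻ : ∀ t n {c k} → n ≤ k → weighted t n (+ c ℤ.- + 2 ℤ.* -[1+ k ]) ≈ 0#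
    weighted-vanish⁻ t n {c} {k} n≤k = begin
      weighted t n (+ c ℤ.- + 2 ℤ.* -[1+ k ])  ≈⟨ weighted-index t n (centred-index⁻ c k) ⟩
      weighted t n (+ (c ℕ.+ suc k ℕ.+ suc k)) ≈⟨ *-congˡ (gauss-vanish (q * q) {n} n<c+2k+2) ⟩
      pow R q t * 0#                           ≈⟨ zeroʳ _ ⟩
      0#                                       ∎
      where
      n<c+2k+2 : n < c ℕ.+ suc k ℕ.+ suc k
      n<c+2k+2 = ℕₚ.≤-trans (s≤s n≤k) (ℕₚ.m≤n+m (suc k) (c ℕ.+ suc k))

    weighted-step-odd : ∀ N i t x y →
      + x ≡ + t ℤ.+ + 2 ℤ.* (+ N ℤ.- i) → + y ≡ + t ℤ.+ (+ 5 ℤ.+ + 2 ℤ.* i) →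
      (weighted t (2 ℕ.+ N) (ℤ.suc (ℤ.suc i)) + q * weighted t N (ℤ.suc i)) + weighted y N (ℤ.suc (ℤ.suc i))
        ≈ ((1# + q) * weighted t (1 ℕ.+ N) (ℤ.suc (ℤ.suc i)) + Q N * weighted t N (ℤ.suc i)) + weighted x N i
    weighted-step-odd N i t x y hx hy = pascal-combination outer inner
      where
      r₁ : + x ℤ.+ + 2 ℤ.* ℤ.suc (ℤ.suc i) ≡ + t ℤ.+ + 2 ℤ.* + suc (suc N)
      r₁ rewrite hx = lin (+ t) (+ N) i
        where
        lin : ∀ T N I → (T ℤ.+ + 2 ℤ.* (N ℤ.- I)) ℤ.+ + 2 ℤ.* (+ 1 ℤ.+ (+ 1 ℤ.+ I))
                        ≡ T ℤ.+ + 2 ℤ.* (+ 1 ℤ.+ (+ 1 ℤ.+ N))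
        lin = ℤ-solve-∀
      r₂ : + (suc N ℕ.+ suc N ℕ.+ t) ≡ + x ℤ.+ + 2 ℤ.* ℤ.suc i
      r₂ rewrite hx = lin (+ t) (+ N) i
        where
        lin : ∀ T N I → (+ 1 ℤ.+ N) ℤ.+ (+ 1 ℤ.+ N) ℤ.+ T
                        ≡ (T ℤ.+ + 2 ℤ.* (N ℤ.- I)) ℤ.+ + 2 ℤ.* (+ 1 ℤ.+ I)
        lin = ℤ-solve-∀
      r₃ : + y ≡ + suc t ℤ.+ + 2 ℤ.* ℤ.suc (ℤ.suc i)
      r₃ rewrite hy = lin (+ t) i
        where
        lin : ∀ T I → T ℤ.+ (+ 5 ℤ.+ + 2 ℤ.* I) ≡ (+ 1 ℤ.+ T) ℤ.+ + 2 ℤ.* (+ 1 ℤ.+ (+ 1 ℤ.+ I))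
        lin = ℤ-solve-∀
      outer : weighted t (2 ℕ.+ N) (ℤ.suc (ℤ.suc i))
              ≈ weighted t (1 ℕ.+ N) (ℤ.suc (ℤ.suc i)) + (weighted x N i + Q N * weighted t N (ℤ.suc i))
      outer = begin
        weighted t (2 ℕ.+ N) (ℤ.suc (ℤ.suc i))
          ≈⟨ weighted-pascal₂ℤ (suc N) (ℤ.suc i) t x r₁ ⟩
        weighted t (1 ℕ.+ N) (ℤ.suc (ℤ.suc i)) + weighted x (1 ℕ.+ N) (ℤ.suc i)
          ≈⟨ +-congˡ (weighted-pascal₁ℤ N i x (suc N ℕ.+ suc N ℕ.+ t) r₂) ⟩
        weighted t (1 ℕ.+ N) (ℤ.suc (ℤ.suc i))
          + (weighted x N i + weighted (suc N ℕ.+ suc N ℕ.+ t) N (ℤ.suc i))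
          ≈⟨ +-congˡ (+-congˡ (weighted-Q N t N (ℤ.suc i))) ⟩
        weighted t (1 ℕ.+ N) (ℤ.suc (ℤ.suc i)) + (weighted x N i + Q N * weighted t N (ℤ.suc i)) ∎
      inner : q * weighted t (1 ℕ.+ N) (ℤ.suc (ℤ.suc i))
              ≈ q * weighted t N (ℤ.suc i) + weighted y N (ℤ.suc (ℤ.suc i))
      inner = begin
        q * weighted t (1 ℕ.+ N) (ℤ.suc (ℤ.suc i))
          ≈⟨ weighted-suc t (1 ℕ.+ N) (ℤ.suc (ℤ.suc i)) ⟩
        weighted (suc t) (1 ℕ.+ N) (ℤ.suc (ℤ.suc i))
          ≈⟨ weighted-pascal₁ℤ N (ℤ.suc i) (suc t) y r₃ ⟩
        weighted (suc t) N (ℤ.suc i) + weighted y N (ℤ.suc (ℤ.suc i))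
          ≈⟨ +-congʳ (sym (weighted-suc t N (ℤ.suc i))) ⟩
        q * weighted t N (ℤ.suc i) + weighted y N (ℤ.suc (ℤ.suc i)) ∎

    weighted-step-even : ∀ N i t x y →
      + x ≡ + t ℤ.+ (+ 1 ℤ.+ + 2 ℤ.* (+ N ℤ.- i)) → + y ≡ + t ℤ.+ (+ 4 ℤ.+ + 2 ℤ.* i) →
      (weighted t (2 ℕ.+ N) (ℤ.suc (ℤ.suc i)) + q * weighted t N (ℤ.suc i)) + weighted x N i
        ≈ ((1# + q) * weighted t (1 ℕ.+ N) (ℤ.suc i) + Q N * weighted t N (ℤ.suc i))
          + weighted y N (ℤ.suc (ℤ.suc i))
    weighted-step-even N i t x y hx hy = pascal-combination outer inner
      where
      r₁ : + y ≡ + t ℤ.+ + 2 ℤ.* ℤ.suc (ℤ.suc i)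
      r₁ rewrite hy = lin (+ t) i
        where
        lin : ∀ T I → T ℤ.+ (+ 4 ℤ.+ + 2 ℤ.* I) ≡ T ℤ.+ + 2 ℤ.* (+ 1 ℤ.+ (+ 1 ℤ.+ I))
        lin = ℤ-solve-∀
      r₂ : + (suc N ℕ.+ suc N ℕ.+ t) ℤ.+ + 2 ℤ.* ℤ.suc (ℤ.suc i) ≡ + y ℤ.+ + 2 ℤ.* + suc N
      r₂ = ≡.trans (lin (+ t) (+ N) i) (cong (λ Y → Y ℤ.+ + 2 ℤ.* + suc N) (≡.sym hy))
        where
        lin : ∀ T N I → ((+ 1 ℤ.+ N) ℤ.+ (+ 1 ℤ.+ N) ℤ.+ T) ℤ.+ + 2 ℤ.* (+ 1 ℤ.+ (+ 1 ℤ.+ I))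
                        ≡ (T ℤ.+ (+ 4 ℤ.+ + 2 ℤ.* I)) ℤ.+ + 2 ℤ.* (+ 1 ℤ.+ N)
        lin = ℤ-solve-∀
      r₃ : + x ℤ.+ + 2 ℤ.* ℤ.suc i ≡ + suc t ℤ.+ + 2 ℤ.* + suc N
      r₃ rewrite hx = lin (+ t) (+ N) i
        where
        lin : ∀ T N I → (T ℤ.+ (+ 1 ℤ.+ + 2 ℤ.* (N ℤ.- I))) ℤ.+ + 2 ℤ.* (+ 1 ℤ.+ I)
                        ≡ (+ 1 ℤ.+ T) ℤ.+ + 2 ℤ.* (+ 1 ℤ.+ N)
        lin = ℤ-solve-∀
      outer : weighted t (2 ℕ.+ N) (ℤ.suc (ℤ.suc i))
              ≈ weighted t (1 ℕ.+ N) (ℤ.suc i) + (weighted y N (ℤ.suc (ℤ.suc i)) + Q N * weighted t N (ℤ.suc i))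
      outer = begin
        weighted t (2 ℕ.+ N) (ℤ.suc (ℤ.suc i))
          ≈⟨ weighted-pascal₁ℤ (suc N) (ℤ.suc i) t y r₁ ⟩
        weighted t (1 ℕ.+ N) (ℤ.suc i) + weighted y (1 ℕ.+ N) (ℤ.suc (ℤ.suc i))
          ≈⟨ +-congˡ (weighted-pascal₂ℤ N (ℤ.suc i) y (suc N ℕ.+ suc N ℕ.+ t) r₂) ⟩
        weighted t (1 ℕ.+ N) (ℤ.suc i)
          + (weighted y N (ℤ.suc (ℤ.suc i)) + weighted (suc N ℕ.+ suc N ℕ.+ t) N (ℤ.suc i))
          ≈⟨ +-congˡ (+-congˡ (weighted-Q N t N (ℤ.suc i))) ⟩
        weighted t (1 ℕ.+ N) (ℤ.suc i) + (weighted y N (ℤ.suc (ℤ.suc i)) + Q N * weighted t N (ℤ.suc i)) ∎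
      inner : q * weighted t (1 ℕ.+ N) (ℤ.suc i) ≈ q * weighted t N (ℤ.suc i) + weighted x N i
      inner = begin
        q * weighted t (1 ℕ.+ N) (ℤ.suc i)            ≈⟨ weighted-suc t (1 ℕ.+ N) (ℤ.suc i) ⟩
        weighted (suc t) (1 ℕ.+ N) (ℤ.suc i)          ≈⟨ weighted-pascal₂ℤ N i (suc t) x r₃ ⟩
        weighted (suc t) N (ℤ.suc i) + weighted x N i ≈⟨ +-congʳ (sym (weighted-suc t N (ℤ.suc i))) ⟩
        q * weighted t N (ℤ.suc i) + weighted x N i   ∎

    -- Tbar R q n is, by definition, Tbar-window n ((n + 2) / 2) n.
    Tbar-window : ℕ → ℕ → ℕ → Carrier
    Tbar-window n c M = sumℤ R (suc M) (λ j → weighted (texp R j) n (+ c ℤ.- + 2 ℤ.* j))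

    Tbar-window-extend : ∀ n {c M} → c ≤ suc n → n ≤ M → Tbar-window n c M ≈ Tbar-window n c n
    Tbar-window-extend n {c} c≤n+1 n≤M =
      sumℤ-extend (λ j → weighted (texp R j) n (+ c ℤ.- + 2 ℤ.* j)) (s≤s n≤M) tail⁺ tail⁻
      where
      tail⁺ : ∀ k → suc n < k → weighted (texp R (+ k)) n (+ c ℤ.- + 2 ℤ.* + k) ≈ 0#
      tail⁺ k n+1<k = weighted-vanish⁺ (texp R (+ k)) n {c} {k}
        (ℕₚ.<-≤-trans (ℕₚ.≤-<-trans c≤n+1 n+1<k) (ℕₚ.m≤m+n k (k ℕ.+ 0)))
      tail⁻ : ∀ k → suc n ≤ k → weighted (texp R -[1+ k ]) n (+ c ℤ.- + 2 ℤ.* -[1+ k ]) ≈ 0#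
      tail⁻ k n<k = weighted-vanish⁻ (texp R -[1+ k ]) n {c} {k} (ℕₚ.<⇒≤ n<k)

    Tbar-certificate : ℕ → ℕ → ℤ → Carrier
    Tbar-certificate N m j = weighted (suc N ℕ.+ certificate-exp j) N (+ m ℤ.- + 2 ℤ.* j)

    Tbar-certificate-vanish : ∀ N m {K} → m < 2 ℕ.* K → N ≤ K →
                              Tbar-certificate N m (+ K) ≈ 0# × Tbar-certificate N m -[1+ K ] ≈ 0#
    Tbar-certificate-vanish N m {K} m<2K N≤K =
      weighted-vanish⁺ (suc N ℕ.+ certificate-exp (+ K)) N {m} {K} m<2K ,
      weighted-vanish⁻ (suc N ℕ.+ certificate-exp -[1+ K ]) N {m} {K} N≤K

    module _ (m : ℕ) where

      private
        N K : ℕ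
        N = suc (m ℕ.+ m)
        K = 3 ℕ.+ N
        A B C : ℤ → Carrier
        A j = weighted (texp R j) (2 ℕ.+ N) (+ (2 ℕ.+ m) ℤ.- + 2 ℤ.* j)
        B j = weighted (texp R j) (1 ℕ.+ N) (+ (2 ℕ.+ m) ℤ.- + 2 ℤ.* j)
        C j = weighted (texp R j) N (+ (1 ℕ.+ m) ℤ.- + 2 ℤ.* j)

      Tbar-step-odd : ∀ j → (A j + q * C j) + Tbar-certificate N m (ℤ.pred j)
                            ≈ ((1# + q) * B j + Q N * C j) + Tbar-certificate N m j
      Tbar-step-odd j = begin
        (A j + q * C j) + Tbar-certificate N m (ℤ.pred j)
          ≈⟨ +-cong (+-cong (weighted-index t (2 ℕ.+ N) (shift-index₂ (+ m) j))
                            (*-congˡ (weighted-index t N (shift-index₁ (+ m) j))))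
                    (weighted-index y N (shift-index-pred (+ m) j)) ⟩
        (weighted t (2 ℕ.+ N) (ℤ.suc (ℤ.suc i)) + q * weighted t N (ℤ.suc i)) + weighted y N (ℤ.suc (ℤ.suc i))
          ≈⟨ weighted-step-odd N i t x y x≡ y≡ ⟩
        ((1# + q) * weighted t (1 ℕ.+ N) (ℤ.suc (ℤ.suc i)) + Q N * weighted t N (ℤ.suc i)) + weighted x N i
          ≈⟨ +-congʳ (+-cong (*-congˡ (weighted-index t (1 ℕ.+ N) (≡.sym (shift-index₂ (+ m) j))))
                             (*-congˡ (weighted-index t N (≡.sym (shift-index₁ (+ m) j))))) ⟩
        ((1# + q) * B j + Q N * C j) + Tbar-certificate N m j ∎
        where
        t x y : ℕ
        t = texp R j
        x = suc N ℕ.+ certificate-exp j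
        y = suc N ℕ.+ certificate-exp (ℤ.pred j)
        i : ℤ
        i = + m ℤ.- + 2 ℤ.* j
        x≡ : + suc N ℤ.+ + certificate-exp j ≡ + t ℤ.+ + 2 ℤ.* (+ N ℤ.- i)
        x≡ = subst-+≡+ (+ suc N) (+certificate-exp j) (+texp j) (lin (+ m) j)
          where
          lin : ∀ M J → (+ 1 ℤ.+ (+ 1 ℤ.+ (M ℤ.+ M))) ℤ.+ (+ 4 ℤ.* J ℤ.* J ℤ.+ J)
                        ≡ (+ 4 ℤ.* J ℤ.* J ℤ.- + 3 ℤ.* J)
                          ℤ.+ + 2 ℤ.* ((+ 1 ℤ.+ (M ℤ.+ M)) ℤ.- (M ℤ.- + 2 ℤ.* J))
          lin = ℤ-solve-∀
        y≡ : + suc N ℤ.+ + certificate-exp (ℤ.pred j) ≡ + t ℤ.+ (+ 5 ℤ.+ + 2 ℤ.* i)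
        y≡ = subst-+≡+ (+ suc N) (+certificate-exp (ℤ.pred j)) (+texp j) (lin (+ m) j)
          where
          lin : ∀ M J → (+ 1 ℤ.+ (+ 1 ℤ.+ (M ℤ.+ M)))
                          ℤ.+ (+ 4 ℤ.* (-1ℤ ℤ.+ J) ℤ.* (-1ℤ ℤ.+ J) ℤ.+ (-1ℤ ℤ.+ J))
                        ≡ (+ 4 ℤ.* J ℤ.* J ℤ.- + 3 ℤ.* J) ℤ.+ (+ 5 ℤ.+ + 2 ℤ.* (M ℤ.- + 2 ℤ.* J))
          lin = ℤ-solve-∀

      Tbar-window-odd :
        Tbar-window (2 ℕ.+ N) (2 ℕ.+ m) (2 ℕ.+ N) + q * Tbar-window N (1 ℕ.+ m) (2 ℕ.+ N)
          ≈ (1# + q) * Tbar-window (1 ℕ.+ N) (2 ℕ.+ m) (2 ℕ.+ N) + Q N * Tbar-window N (1 ℕ.+ m) (2 ℕ.+ N)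
      Tbar-window-odd =
        sumℤ-balance K {A} {B} {C} q (1# + q) (Q N) (cancel-zeros (sumℤ-telescope K Tbar-step-odd) below above)
        where
        m<2K : m < 2 ℕ.* K
        m<2K = ℕₚ.<-≤-trans (s≤s (ℕₚ.≤-trans (ℕₚ.m≤m+n m m) (ℕₚ.m≤n+m (m ℕ.+ m) 3)))
                            (ℕₚ.m≤m+n K (K ℕ.+ 0))
        above : Tbar-certificate N m (+ K) ≈ 0#
        above = proj₁ (Tbar-certificate-vanish N m m<2K (ℕₚ.m≤n+m N 3))
        below : Tbar-certificate N m -[1+ K ] ≈ 0#
        below = proj₂ (Tbar-certificate-vanish N m m<2K (ℕₚ.m≤n+m N 3))

    module _ (m : ℕ) where

      private
        N K : ℕ
        N = m ℕ.+ m
        K = 3 ℕ.+ N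
        A B C : ℤ → Carrier
        A j = weighted (texp R j) (2 ℕ.+ N) (+ (2 ℕ.+ m) ℤ.- + 2 ℤ.* j)
        B j = weighted (texp R j) (1 ℕ.+ N) (+ (1 ℕ.+ m) ℤ.- + 2 ℤ.* j)
        C j = weighted (texp R j) N (+ (1 ℕ.+ m) ℤ.- + 2 ℤ.* j)

      Tbar-step-even : ∀ j → (A j + q * C j) + Tbar-certificate N m j
                             ≈ ((1# + q) * B j + Q N * C j) + Tbar-certificate N m (ℤ.pred j)
      Tbar-step-even j = begin
        (A j + q * C j) + Tbar-certificate N m j
          ≈⟨ +-congʳ (+-cong (weighted-index t (2 ℕ.+ N) (shift-index₂ (+ m) j))
                             (*-congˡ (weighted-index t N (shift-index₁ (+ m) j)))) ⟩
        (weighted t (2 ℕ.+ N) (ℤ.suc (ℤ.suc i)) + q * weighted t N (ℤ.suc i)) + weighted x N i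
          ≈⟨ weighted-step-even N i t x y x≡ y≡ ⟩
        ((1# + q) * weighted t (1 ℕ.+ N) (ℤ.suc i) + Q N * weighted t N (ℤ.suc i)) + weighted y N (ℤ.suc (ℤ.suc i))
          ≈⟨ +-cong (+-cong (*-congˡ (weighted-index t (1 ℕ.+ N) (≡.sym (shift-index₁ (+ m) j))))
                            (*-congˡ (weighted-index t N (≡.sym (shift-index₁ (+ m) j)))))
                    (weighted-index y N (≡.sym (shift-index-pred (+ m) j))) ⟩
        ((1# + q) * B j + Q N * C j) + Tbar-certificate N m (ℤ.pred j) ∎
        where
        t x y : ℕ
        t = texp R j
        x = suc N ℕ.+ certificate-exp j
        y = suc N ℕ.+ certificate-exp (ℤ.pred j)
        i : ℤ
        i = + m ℤ.- + 2 ℤ.* j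
        x≡ : + suc N ℤ.+ + certificate-exp j ≡ + t ℤ.+ (+ 1 ℤ.+ + 2 ℤ.* (+ N ℤ.- i))
        x≡ = subst-+≡+ (+ suc N) (+certificate-exp j) (+texp j) (lin (+ m) j)
          where
          lin : ∀ M J → (+ 1 ℤ.+ (M ℤ.+ M)) ℤ.+ (+ 4 ℤ.* J ℤ.* J ℤ.+ J)
                        ≡ (+ 4 ℤ.* J ℤ.* J ℤ.- + 3 ℤ.* J)
                          ℤ.+ (+ 1 ℤ.+ + 2 ℤ.* ((M ℤ.+ M) ℤ.- (M ℤ.- + 2 ℤ.* J)))
          lin = ℤ-solve-∀
        y≡ : + suc N ℤ.+ + certificate-exp (ℤ.pred j) ≡ + t ℤ.+ (+ 4 ℤ.+ + 2 ℤ.* i)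
        y≡ = subst-+≡+ (+ suc N) (+certificate-exp (ℤ.pred j)) (+texp j) (lin (+ m) j)
          where
          lin : ∀ M J → (+ 1 ℤ.+ (M ℤ.+ M))
                          ℤ.+ (+ 4 ℤ.* (-1ℤ ℤ.+ J) ℤ.* (-1ℤ ℤ.+ J) ℤ.+ (-1ℤ ℤ.+ J))
                        ≡ (+ 4 ℤ.* J ℤ.* J ℤ.- + 3 ℤ.* J) ℤ.+ (+ 4 ℤ.+ + 2 ℤ.* (M ℤ.- + 2 ℤ.* J))
          lin = ℤ-solve-∀

      Tbar-window-even :
        Tbar-window (2 ℕ.+ N) (2 ℕ.+ m) (2 ℕ.+ N) + q * Tbar-window N (1 ℕ.+ m) (2 ℕ.+ N)
          ≈ (1# + q) * Tbar-window (1 ℕ.+ N) (1 ℕ.+ m) (2 ℕ.+ N) + Q N * Tbar-window N (1 ℕ.+ m) (2 ℕ.+ N)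
      Tbar-window-even =
        sumℤ-balance K {A} {B} {C} q (1# + q) (Q N)
          (sym (cancel-zeros (sumℤ-telescope K (λ j → sym (Tbar-step-even j))) below above))
        where
        m<2K : m < 2 ℕ.* K
        m<2K = ℕₚ.<-≤-trans (s≤s (ℕₚ.≤-trans (ℕₚ.m≤m+n m m) (ℕₚ.m≤n+m (m ℕ.+ m) 2)))
                            (ℕₚ.m≤m+n K (K ℕ.+ 0))
        above : Tbar-certificate N m (+ K) ≈ 0#
        above = proj₁ (Tbar-certificate-vanish N m m<2K (ℕₚ.m≤n+m N 3))
        below : Tbar-certificate N m -[1+ K ] ≈ 0#
        below = proj₂ (Tbar-certificate-vanish N m m<2K (ℕₚ.m≤n+m N 3))

    Tbar-balanced-from-window : ∀ N {c₂ c₁ c₀} →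
      (2 ℕ.+ N ℕ.+ 2) / 2 ≡ c₂ → (1 ℕ.+ N ℕ.+ 2) / 2 ≡ c₁ → (N ℕ.+ 2) / 2 ≡ c₀ →
      Tbar-window (2 ℕ.+ N) c₂ (2 ℕ.+ N) + q * Tbar-window N c₀ (2 ℕ.+ N)
        ≈ (1# + q) * Tbar-window (1 ℕ.+ N) c₁ (2 ℕ.+ N) + Q N * Tbar-window N c₀ (2 ℕ.+ N) →
      Tbar R q (2 ℕ.+ N) + q * Tbar R q N ≈ (1# + q) * Tbar R q (1 ℕ.+ N) + Q N * Tbar R q N
    Tbar-balanced-from-window N ≡.refl ≡.refl ≡.refl window = begin
      Tbar R q (2 ℕ.+ N) + q * Tbar R q N
        ≈⟨ +-congˡ (*-congˡ (sym (Tbar-window-extend N ([n+2]/2≤1+n N) (ℕₚ.m≤n+m N 2)))) ⟩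
      Tbar R q (2 ℕ.+ N) + q * Tbar-window N ((N ℕ.+ 2) / 2) (2 ℕ.+ N)
        ≈⟨ window ⟩
      (1# + q) * Tbar-window (1 ℕ.+ N) ((1 ℕ.+ N ℕ.+ 2) / 2) (2 ℕ.+ N)
        + Q N * Tbar-window N ((N ℕ.+ 2) / 2) (2 ℕ.+ N)
        ≈⟨ +-cong (*-congˡ (Tbar-window-extend (1 ℕ.+ N) ([n+2]/2≤1+n (1 ℕ.+ N)) (ℕₚ.n≤1+n _)))
                  (*-congˡ (Tbar-window-extend N ([n+2]/2≤1+n N) (ℕₚ.m≤n+m N 2))) ⟩
      (1# + q) * Tbar R q (1 ℕ.+ N) + Q N * Tbar R q N ∎

    Tbar-balanced : ∀ n → Tbar R q (2 ℕ.+ n) + q * Tbar R q n ≈ (1# + q) * Tbar R q (1 ℕ.+ n) + Q n * Tbar R q n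
    Tbar-balanced n with even-or-odd n
    ... | inj₁ (m , ≡.refl) = Tbar-balanced-from-window (m ℕ.+ m)
      ([d+[m+m]+2]/2≡[d+2]/2+m 2 m) ([d+[m+m]+2]/2≡[d+2]/2+m 1 m) ([d+[m+m]+2]/2≡[d+2]/2+m 0 m)
      (Tbar-window-even m)
    ... | inj₂ (m , ≡.refl) = Tbar-balanced-from-window (suc (m ℕ.+ m))
      ([d+[m+m]+2]/2≡[d+2]/2+m 3 m) ([d+[m+m]+2]/2≡[d+2]/2+m 2 m) ([d+[m+m]+2]/2≡[d+2]/2+m 1 m)
      (Tbar-window-odd m)

mainTheorem4 : ∀ {c ℓ : Level} (R : CommutativeRing c ℓ) (q : CommutativeRing.Carrier R) (n : ℕ) →
    let open CommutativeRing R in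
    ((T R q (2 Data.Nat.+ n) - (1# + q) * T R q (1 Data.Nat.+ n)) + (q - pow R q (2 Data.Nat.* n Data.Nat.+ 2)) * T R q n ≈ 0#)
    × ((Tbar R q (2 Data.Nat.+ n) - (1# + q) * Tbar R q (1 Data.Nat.+ n)) + (q - pow R q (2 Data.Nat.* n Data.Nat.+ 2)) * Tbar R q n ≈ 0#)
mainTheorem4 R q n = recurrence-of-balance R (T-balanced R q n) , recurrence-of-balance R (Tbar-balanced R q n)
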